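{- Let $\mathcal Z$ be a finite zero-set, let $a,b$ be positive integers with $R_{a,b}\subseteq\mathcal Z$, and let $Y$ be a nonempty Young diagram with $Y\subseteq R_{a-1,b-1}$. Then $$\gamma(\mathcal Z)\ge\frac12\min_{(k,\ell)\in\partial_oY}\Big(kb+\ell a-k\ell+\gamma(\mathcal Z^{\downarrow\ell})+\gamma(\mathcal Z^{\leftarrow k})\Big).$$
   Context: $\mathbb Z_+=\{0,1,2,\dots\}$; $R_{a,b}=([0,a-1]\times[0,b-1])\cap\mathbb Z_+^2$ for positive integers $a,b$. A zero-set is a union of sets $R_{a,b}$ (possibly empty); a finite zero-set is a Young diagram. For $A\subseteq\mathbb Z_+^2$, $\mathrm{row}(x,A)$, $\mathrm{col}(x,A)$ are the numbers of points of $A$ on the horizontal/vertical line through $x$; the growth transformation is $\mathcal T(A)=A\cup\{x\notin A:(\mathrm{row}(x,A),\mathrm{col}(x,A))\notin\mathcal Z\}$; $A$ spans if $\bigcup_t\mathcal T^t(A)=\mathbb Z_+^2$; $\gamma(\mathcal Z)$ is the minimal size of a finite spanning set. $\mathcal Z^{\downarrow \ell}=\{(u,v-\ell):(u,v)\in\mathcal Z,v\ge \ell\}$ and $\mathcal Z^{\leftarrow k}=\{(u-k,v):(u,v)\in\mathcal Z,u\ge k\}$. The outside boundary of a Young diagram $Y$ is $\partial_oY=\{(u,v)\in\mathbb Z_+^2\setminus Y:(u-1,v)\in Y\text{ or }(u,v-1)\in Y\}$. -}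

module Defs where

open import Data.Nat using (ℕ; zero; suc; _+_; _*_; _∸_; _<_; _≤_)
open import Data.Product using (Σ; ∃; ∃-syntax; _×_; _,_)
open import Data.Sum using (_⊎_)
open import Data.List using (List; length)
open import Data.List.Relation.Unary.All using (All)
open import Data.List.Relation.Unary.Any using (Any)
open import Data.List.Relation.Unary.Unique.Propositional using (Unique)
open import Data.List.Membership.Propositional using (_∈_)
open import Relation.Nullary using (¬_)
open import Relation.Binary.PropositionalEquality using (_≡_)

Set² : Set₁
Set² = ℕ → ℕ → Set

Rect : ℕ → ℕ → Set²
Rect a b u v = (u < a) × (v < b)

-- A finite union of rectangles R_{a,b}, given by the list of (a , b).
-- Every finite zero-set (Young diagram) is of this form.
UnionRects : List (ℕ × ℕ) → Set²
UnionRects rs u v = Any (λ { (a , b) → Rect a b u v }) rs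

_⊆²_ : Set² → Set² → Set
S ⊆² T = ∀ u v → S u v → T u v

shiftDown : ℕ → Set² → Set²
shiftDown ℓ Z u v = Z u (v + ℓ)

shiftLeft : ℕ → Set² → Set²
shiftLeft k Z u v = Z (u + k) v

RowAtLeast : Set² → ℕ → ℕ → Set
RowAtLeast S v r = Σ (List ℕ) λ us → length us ≡ r × Unique us × All (λ u → S u v) us

ColAtLeast : Set² → ℕ → ℕ → Set
ColAtLeast S u c = Σ (List ℕ) λ vs → length vs ≡ c × Unique vs × All (λ v → S u v) vs

-- Growth transformation T(S) = S ∪ {x ∉ S : (row(x,S), col(x,S)) ∉ Z}.
-- Since Z is a down-set, (row,col) ∉ Z iff some (r,c) ∉ Z with r ≤ row, c ≤ col
-- (this also covers infinite row/column counts).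
growth : Set² → Set² → Set²
growth Z S u v =
  S u v ⊎ ((¬ S u v) × ∃[ r ] ∃[ c ] ((¬ Z r c) × RowAtLeast S v r × ColAtLeast S u c))

growthIter : Set² → Set² → ℕ → Set²
growthIter Z S zero = S
growthIter Z S (suc t) = growth Z (growthIter Z S t)

listSet : List (ℕ × ℕ) → Set²
listSet A u v = (u , v) ∈ A

Spans : Set² → Set² → Set
Spans Z S = ∀ u v → ∃[ t ] growthIter Z S t u v

IsGamma : Set² → ℕ → Set
IsGamma Z g =
  (Σ (List (ℕ × ℕ)) λ A → Unique A × length A ≡ g × Spans Z (listSet A))
  × (∀ (A : List (ℕ × ℕ)) → Unique A → Spans Z (listSet A) → g ≤ length A)

OutBoundary : Set² → Set²
OutBoundary Y k ℓ =
  (¬ Y k ℓ) × ((∃[ k' ] (k ≡ suc k' × Y k' ℓ)) ⊎ (∃[ ℓ' ] (ℓ ≡ suc ℓ' × Y k ℓ')))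

-- Fix a spanning set A of size γ(Z). Since R_{a,b} ⊆ Z, the growth only ever adds a point on a row
-- holding at least a points or on a column holding at least b points. List the columns C and rows R
-- that become full in this sense, in the order in which they do, and stop as soon as (|C|, |R|)
-- leaves Y; it does leave, since eventually every column below a is full while Y ⊆ R_{a-1,b-1}, so
-- it stops at a point (k, ℓ) of ∂_oY. A column that becomes full after the rows in R gets its b
-- points from A or from those rows, and symmetrically for rows, whence
-- kb + ℓa ≤ |A ∩ cols C| + |A ∩ rows R| + kℓ. Deleting the rows R from A and closing up the gaps
-- leaves a set spanning Z^{↓ℓ}, and deleting the columns C one spanning Z^{←k}; adding
-- γ(Z^{↓ℓ}) ≤ |A ∖ rows R| and γ(Z^{←k}) ≤ |A ∖ cols C| to the first inequality gives the bound
-- by 2|A|. The walk is run under double negation (fullness of a line is not decided along the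
-- way), which is harmless because the conclusion is a bounded, decidable statement.

module Submission where

open import Defs
open import Level using (0ℓ)
open import Data.Nat using (ℕ; zero; suc; _+_; _*_; _∸_; _<_; _≤_; _≤′_; ≤′-refl; ≤′-step; z≤n; s≤s; pred; _⊔_; _<?_; _≤?_; _≟_; anyUpTo?)
open import Data.Nat.Properties
open import Data.Product using (Σ; ∃; ∃-syntax; _×_; _,_; proj₁; proj₂; swap)
open import Data.Sum using (_⊎_; inj₁; inj₂)
open import Data.Empty using (⊥; ⊥-elim)
open import Function using (_∘_; flip; id)
open import Relation.Nullary using (¬_; Dec; yes; no; ¬?; contradiction)
open import Relation.Nullary.Decidable using (_×-dec_; _⊎-dec_; map′; dec-yes; decidable-stable; ¬¬-excluded-middle)
open import Relation.Nullary.Negation using (DoubleNegation; ¬¬-Monad)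
open import Effect.Monad using (RawMonad)
open import Relation.Unary using (Pred; Decidable; ∁)
open import Relation.Unary.Properties using (∁?)
open import Relation.Binary.Definitions using (DecidableEquality)
open import Data.Nat.Tactic.RingSolver using (solve-∀)
open import Relation.Binary.PropositionalEquality using (_≡_; _≢_; refl; sym; trans; cong; cong₂; subst; module ≡-Reasoning)
open import Data.List using (List; []; _∷_; length; map; filter; upTo; _++_)
open import Data.List.Properties using (length-map; length-++; filter-notAll; length-upTo; filter-all)
open import Data.List.Relation.Unary.All as All using (All; []; _∷_)
import Data.List.Relation.Unary.All.Properties as All
open import Data.List.Relation.Unary.Any as Any using (Any; here; there)
import Data.List.Relation.Unary.Any.Properties as Any
open import Data.List.Relation.Unary.Unique.Propositional using (Unique)
import Data.List.Relation.Unary.Unique.Propositional.Properties as Unique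
open import Data.List.Relation.Unary.AllPairs using ([]; _∷_)
open import Data.List.Membership.Propositional using (_∈_; _∉_)
open import Data.List.Membership.Propositional.Properties
import Data.List.Membership.DecPropositional as DecMembership
open import Data.Product.Properties using (≡-dec)
open DecMembership _≟_ using () renaming (_∈?_ to _∈ℕ?_)
open import Data.List.Relation.Binary.Subset.Propositional using (_⊆_)

-- Counting in lists

module _ {A : Set} (_≟_ : DecidableEquality A) where

  Unique-⊆⇒length≤ : ∀ {xs ys : List A} → Unique xs → xs ⊆ ys → length xs ≤ length ys
  Unique-⊆⇒length≤ {[]} _ _ = z≤n
  Unique-⊆⇒length≤ {x ∷ xs} {ys} (x∉xs ∷ uxs) x∷xs⊆ys =
    ≤-trans (s≤s (Unique-⊆⇒length≤ uxs xs⊆ys-x)) (filter-notAll ≢x? ys x∈ys)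
    where
    ≢x? : Decidable (_≢ x)
    ≢x? y = ¬? (y ≟ x)
    x∈ys : Any (∁ (_≢ x)) ys
    x∈ys = Any.map (λ y≡x y≢x → y≢x (sym y≡x)) (x∷xs⊆ys (here refl))
    xs⊆ys-x : xs ⊆ filter ≢x? ys
    xs⊆ys-x z∈xs = ∈-filter⁺ ≢x? (x∷xs⊆ys (there z∈xs)) (λ z≡x → All.lookup x∉xs z∈xs (sym z≡x))

∷-unique : ∀ {A : Set} {x : A} {xs} → x ∉ xs → Unique xs → Unique (x ∷ xs)
∷-unique {xs = xs} x∉xs uxs = All.¬Any⇒All¬ xs x∉xs ∷ uxs

map-unique-on : ∀ {A B : Set} {P : Pred A 0ℓ} (f : A → B) →
  (∀ {x y} → P x → P y → f x ≡ f y → x ≡ y) → ∀ {xs} → All P xs → Unique xs → Unique (map f xs)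
map-unique-on f inj [] [] = []
map-unique-on f inj (px ∷ pxs) (x∉xs ∷ uxs) =
  All.map⁺ (All.zipWith (λ (py , x≢y) fx≡fy → x≢y (inj px py fx≡fy)) (pxs , x∉xs))
  ∷ map-unique-on f inj pxs uxs

module _ {A : Set} {P Q T : Pred A 0ℓ} (P? : Decidable P) (Q? : Decidable Q) (T? : Decidable T) where

  length-filter-disjoint : (∀ {x} → P x → Q x → ⊥) → (∀ {x} → P x → T x) → (∀ {x} → Q x → T x) →
    ∀ xs → length (filter P? xs) + length (filter Q? xs) ≤ length (filter T? xs)
  length-filter-disjoint disj P⊆T Q⊆T [] = z≤n
  length-filter-disjoint disj P⊆T Q⊆T (x ∷ xs)
    with ih ← length-filter-disjoint disj P⊆T Q⊆T xs | P? x | Q? x | T? x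
  ... | yes p | yes q | _     = ⊥-elim (disj p q)
  ... | yes _ | no _  | yes _ = s≤s ih
  ... | no _  | yes _ | yes _ = ≤-trans (≤-reflexive (+-suc _ _)) (s≤s ih)
  ... | no _  | no _  | yes _ = m≤n⇒m≤1+n ih
  ... | no _  | no _  | no _  = ih
  ... | yes p | no _  | no ¬t = contradiction (P⊆T p) ¬t
  ... | no _  | yes q | no ¬t = contradiction (Q⊆T q) ¬t

  length-filter-filter : (∀ {x} → P x → Q x → T x) →
    ∀ xs → length (filter Q? (filter P? xs)) ≤ length (filter T? xs)
  length-filter-filter P∩Q⊆T [] = z≤n
  length-filter-filter P∩Q⊆T (x ∷ xs) with ih ← length-filter-filter P∩Q⊆T xs | P? x | T? x
  ... | no _  | yes _ = m≤n⇒m≤1+n ih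
  ... | no _  | no _  = ih
  ... | yes p | T?x with Q? x | T?x
  ...   | yes _ | yes _ = s≤s ih
  ...   | yes q | no ¬t = contradiction (P∩Q⊆T p q) ¬t
  ...   | no _  | yes _ = m≤n⇒m≤1+n ih
  ...   | no _  | no _  = ih

module _ {A : Set} {P : Pred A 0ℓ} (P? : Decidable P) where

  length-filter-∁+length-filter : ∀ xs → length (filter (∁? P?) xs) + length (filter P? xs) ≡ length xs
  length-filter-∁+length-filter [] = refl
  length-filter-∁+length-filter (x ∷ xs) with ih ← length-filter-∁+length-filter xs | P? x
  ... | yes _ = trans (+-suc _ _) (cong suc ih)
  ... | no _  = cong suc ih

  length-filter-map : ∀ {B : Set} (f : B → A) xs → length (filter P? (map f xs)) ≡ length (filter (P? ∘ f) xs)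
  length-filter-map f [] = refl
  length-filter-map f (x ∷ xs) with P? (f x)
  ... | yes _ = cong suc (length-filter-map f xs)
  ... | no _  = length-filter-map f xs

-- Finite zero-sets

Bounded : Set² → ℕ → Set
Bounded S B = ∀ {u v} → S u v → u < B × v < B

record FiniteZeroSet (Z : Set²) : Set where
  field
    dec : ∀ r c → Dec (Z r c)
    down-closed : ∀ {r c r′ c′} → r′ ≤ r → c′ ≤ c → Z r c → Z r′ c′
    bound : ℕ
    bounded : Bounded Z bound

rectsBound : List (ℕ × ℕ) → ℕ
rectsBound [] = 0
rectsBound ((a , b) ∷ rs) = a ⊔ b ⊔ rectsBound rs

UnionRects-bounded : ∀ rs → Bounded (UnionRects rs) (rectsBound rs)
UnionRects-bounded ((a , b) ∷ rs) (here (u<a , v<b)) =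
  <-≤-trans u<a (≤-trans (m≤m⊔n a b) (m≤m⊔n (a ⊔ b) _)) ,
  <-≤-trans v<b (≤-trans (m≤n⊔m a b) (m≤m⊔n (a ⊔ b) _))
UnionRects-bounded ((a , b) ∷ rs) (there uv∈rs) with UnionRects-bounded rs uv∈rs
... | u< , v< = <-≤-trans u< (m≤n⊔m (a ⊔ b) _) , <-≤-trans v< (m≤n⊔m (a ⊔ b) _)

UnionRects-zeroSet : ∀ rs → FiniteZeroSet (UnionRects rs)
UnionRects-zeroSet rs = record
  { dec = λ r c → Any.any? (λ (a , b) → (r <? a) ×-dec (c <? b)) rs
  ; down-closed = λ r′≤r c′≤c → Any.map (λ (r<a , c<b) → ≤-<-trans r′≤r r<a , ≤-<-trans c′≤c c<b)
  ; bound = rectsBound rs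
  ; bounded = UnionRects-bounded rs
  }

shiftDown-zeroSet : ∀ {Z} ℓ → FiniteZeroSet Z → FiniteZeroSet (shiftDown ℓ Z)
shiftDown-zeroSet ℓ 𝒵 = record
  { dec = λ r c → dec r (c + ℓ)
  ; down-closed = λ r′≤r c′≤c → down-closed r′≤r (+-monoˡ-≤ ℓ c′≤c)
  ; bound = bound
  ; bounded = λ z → let r< , c+ℓ< = bounded z in r< , ≤-<-trans (m≤m+n _ ℓ) c+ℓ<
  }
  where open FiniteZeroSet 𝒵

flip-zeroSet : ∀ {Z} → FiniteZeroSet Z → FiniteZeroSet (flip Z)
flip-zeroSet 𝒵 = record
  { dec = flip dec
  ; down-closed = λ r′≤r c′≤c → down-closed c′≤c r′≤r
  ; bound = bound
  ; bounded = swap ∘ bounded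
  }
  where open FiniteZeroSet 𝒵

-- Growth under extensional equality and transposition

infix 4 _≐_

_≐_ : Set² → Set² → Set
S ≐ T = ∀ u v → (S u v → T u v) × (T u v → S u v)

≐-refl : ∀ {S} → S ≐ S
≐-refl u v = id , id

≐-sym : ∀ {S T} → S ≐ T → T ≐ S
≐-sym S≐T u v = swap (S≐T u v)

≐-trans : ∀ {S T U} → S ≐ T → T ≐ U → S ≐ U
≐-trans S≐T T≐U u v = proj₁ (T≐U u v) ∘ proj₁ (S≐T u v) , proj₂ (S≐T u v) ∘ proj₂ (T≐U u v)

RowAtLeast-map : ∀ {S T v v′ n} → (∀ {u} → S u v → T u v′) → RowAtLeast S v n → RowAtLeast T v′ n
RowAtLeast-map f (us , len , uus , all) = us , len , uus , All.map f all

ColAtLeast-map : ∀ {S T u u′ n} → (∀ {v} → S u v → T u′ v) → ColAtLeast S u n → ColAtLeast T u′ n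
ColAtLeast-map f (vs , len , uvs , all) = vs , len , uvs , All.map f all

growth-⊆ : ∀ {Z Z′ S T} → Z′ ⊆² Z → S ≐ T → growth Z S ⊆² growth Z′ T
growth-⊆ Z′⊆Z S≐T u v (inj₁ s) = inj₁ (proj₁ (S≐T u v) s)
growth-⊆ {S = S} {T} Z′⊆Z S≐T u v (inj₂ (s∉ , r , c , rc∉Z , row , col)) =
  inj₂ (s∉ ∘ proj₂ (S≐T u v) , r , c , rc∉Z ∘ Z′⊆Z r c ,
        RowAtLeast-map {S} {T} (proj₁ (S≐T _ v)) row , ColAtLeast-map {S} {T} (proj₁ (S≐T u _)) col)

growth-cong : ∀ {Z Z′ S T} → Z ≐ Z′ → S ≐ T → growth Z S ≐ growth Z′ T
growth-cong Z≐Z′ S≐T u v =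
  growth-⊆ (λ r c → proj₂ (Z≐Z′ r c)) S≐T u v ,
  growth-⊆ (λ r c → proj₁ (Z≐Z′ r c)) (≐-sym S≐T) u v

growthIter-cong : ∀ {Z Z′ S T} → Z ≐ Z′ → S ≐ T → ∀ t → growthIter Z S t ≐ growthIter Z′ T t
growthIter-cong Z≐Z′ S≐T zero = S≐T
growthIter-cong Z≐Z′ S≐T (suc t) = growth-cong Z≐Z′ (growthIter-cong Z≐Z′ S≐T t)

Spans-cong : ∀ {Z Z′ S T} → Z ≐ Z′ → S ≐ T → Spans Z S → Spans Z′ T
Spans-cong Z≐Z′ S≐T spans u v =
  let t , s = spans u v in t , proj₁ (growthIter-cong Z≐Z′ S≐T t u v) s

growth-flip : ∀ Z S → growth (flip Z) (flip S) ≐ flip (growth Z S)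
growth-flip Z S u v = transpose {flip Z} {flip S} , transpose {Z} {S}
  where
  transpose : ∀ {Z S u v} → growth Z S u v → growth (flip Z) (flip S) v u
  transpose (inj₁ s) = inj₁ s
  transpose (inj₂ (s∉ , r , c , rc∉Z , row , col)) = inj₂ (s∉ , c , r , rc∉Z , col , row)

growthIter-flip : ∀ Z S t → growthIter (flip Z) (flip S) t ≐ flip (growthIter Z S t)
growthIter-flip Z S zero = ≐-refl
growthIter-flip Z S (suc t) =
  ≐-trans (growth-cong ≐-refl (growthIter-flip Z S t)) (growth-flip Z (growthIter Z S t))

listSet-swap : ∀ A → listSet (map swap A) ≐ flip (listSet A)
listSet-swap A u v = from , ∈-map⁺ swap
  where
  from : (u , v) ∈ map swap A → (v , u) ∈ A
  from uv∈ with ∈-map⁻ swap uv∈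
  ... | _ , vu∈ , refl = vu∈

Spans-flip : ∀ Z A → Spans Z (listSet A) → Spans (flip Z) (listSet (map swap A))
Spans-flip Z A spans u v =
  let t , s = spans v u
  in t , proj₂ (growthIter-cong ≐-refl (listSet-swap A) t u v) (proj₂ (growthIter-flip Z (listSet A) t u v) s)

-- Decidability of the growth

Grows : Set² → Set² → ℕ → ℕ → Set
Grows Z S u v = ∃[ r ] ∃[ c ] ((¬ Z r c) × RowAtLeast S v r × ColAtLeast S u c)

-- Beyond B a tame set is constant along rows and columns, so each of its rows holds either
-- infinitely many points or only those left of B; this makes the growth step decidable.
record Tame (S : Set²) (B : ℕ) : Set where
  field
    dec : ∀ u v → Dec (S u v)
    stable-column : ∀ {u} v → B ≤ u → (S u v → S B v) × (S B v → S u v)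
    stable-row : ∀ u {v} → B ≤ v → (S u v → S u B) × (S u B → S u v)

flip-tame : ∀ {S B} → Tame S B → Tame (flip S) B
flip-tame τ = record { dec = flip dec ; stable-column = λ v → stable-row v ; stable-row = λ u → stable-column u }
  where open Tame τ

module RowCount {S : Set²} {B : ℕ} (τ : Tame S B) where
  open Tame τ

  pointsBefore : ℕ → List ℕ
  pointsBefore v = filter (λ u → dec u v) (upTo B)

  RowAtLeast-pointsBefore : ∀ v → RowAtLeast S v (length (pointsBefore v))
  RowAtLeast-pointsBefore v =
    pointsBefore v , refl , Unique.filter⁺ (λ u → dec u v) (Unique.upTo⁺ B) ,
    All.all-filter (λ u → dec u v) (upTo B)

  RowAtLeast-full : ∀ {v} → S B v → ∀ n → RowAtLeast S v n
  RowAtLeast-full {v} s n =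
    map (B +_) (upTo n) , trans (length-map _ (upTo n)) (length-upTo n) ,
    Unique.map⁺ (+-cancelˡ-≡ B _ _) (Unique.upTo⁺ n) ,
    All.map⁺ (All.tabulate (λ {i} _ → proj₂ (stable-column v (m≤m+n B i)) s))

  RowAtLeast⇒≤pointsBefore : ∀ {v r} → ¬ S B v → RowAtLeast S v r → r ≤ length (pointsBefore v)
  RowAtLeast⇒≤pointsBefore {v} ¬s (us , refl , uus , all) = Unique-⊆⇒length≤ _≟_ uus us⊆
    where
    us⊆ : us ⊆ pointsBefore v
    us⊆ {u} u∈us with u <? B
    ... | yes u<B = ∈-filter⁺ (λ u → dec u v) (∈-upTo⁺ u<B) (All.lookup all u∈us)
    ... | no u≮B = contradiction (proj₁ (stable-column v (≮⇒≥ u≮B)) (All.lookup all u∈us)) ¬s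

growth-transfer-column : ∀ {Z S u u′ v} → (∀ w → S u w → S u′ w) → (S u′ v → S u v) →
  growth Z S u v → growth Z S u′ v
growth-transfer-column S⊆ S⊇ (inj₁ s) = inj₁ (S⊆ _ s)
growth-transfer-column {S = S} S⊆ S⊇ (inj₂ (s∉ , r , c , ∉Z , row , col)) =
  inj₂ (s∉ ∘ S⊇ , r , c , ∉Z , row , ColAtLeast-map {S} {S} (S⊆ _) col)

growth-transfer-row : ∀ {Z S u v v′} → (∀ w → S w v → S w v′) → (S u v′ → S u v) →
  growth Z S u v → growth Z S u v′
growth-transfer-row S⊆ S⊇ (inj₁ s) = inj₁ (S⊆ _ s)
growth-transfer-row {S = S} S⊆ S⊇ (inj₂ (s∉ , r , c , ∉Z , row , col)) =
  inj₂ (s∉ ∘ S⊇ , r , c , ∉Z , RowAtLeast-map {S} {S} (S⊆ _) row , col)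

module _ {Z S B} (𝒵 : FiniteZeroSet Z) (τ : Tame S B) where
  open FiniteZeroSet 𝒵 renaming (dec to Z?)
  open Tame τ renaming (dec to S?)
  private
    module Row = RowCount τ
    module Col = RowCount (flip-tame τ)

  grows? : ∀ u v → Dec (Grows Z S u v)
  grows? u v with S? B v | S? u B
  ... | yes full | _ =
    yes (bound , 0 , n≮n bound ∘ proj₁ ∘ bounded , Row.RowAtLeast-full full bound , [] , refl , [] , [])
  ... | no _ | yes full =
    yes (0 , bound , n≮n bound ∘ proj₂ ∘ bounded , ([] , refl , [] , []) , Col.RowAtLeast-full full bound)
  ... | no ¬row | no ¬col with Z? (length (Row.pointsBefore v)) (length (Col.pointsBefore u))
  ...   | no ∉Z = yes (_ , _ , ∉Z , Row.RowAtLeast-pointsBefore v , Col.RowAtLeast-pointsBefore u)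
  ...   | yes ∈Z = no λ (r , c , ∉Z , row , col) →
            ∉Z (down-closed (Row.RowAtLeast⇒≤pointsBefore ¬row row) (Col.RowAtLeast⇒≤pointsBefore ¬col col) ∈Z)

  growth-tame : Tame (growth Z S) B
  growth-tame = record
    { dec = λ u v → S? u v ⊎-dec (¬? (S? u v) ×-dec grows? u v)
    ; stable-column = λ v B≤u →
        growth-transfer-column {Z} {S} (λ w → proj₁ (stable-column w B≤u)) (proj₂ (stable-column v B≤u)) ,
        growth-transfer-column {Z} {S} (λ w → proj₂ (stable-column w B≤u)) (proj₁ (stable-column v B≤u))
    ; stable-row = λ u B≤v →
        growth-transfer-row {Z} {S} (λ w → proj₁ (stable-row w B≤v)) (proj₂ (stable-row u B≤v)) ,
        growth-transfer-row {Z} {S} (λ w → proj₂ (stable-row w B≤v)) (proj₁ (stable-row u B≤v))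
    }

growthIter-tame : ∀ {Z S B} → FiniteZeroSet Z → Tame S B → ∀ t → Tame (growthIter Z S t) B
growthIter-tame 𝒵 τ zero = τ
growthIter-tame 𝒵 τ (suc t) = growth-tame 𝒵 (growthIter-tame 𝒵 τ t)

bounded-tame : ∀ {S B} → (∀ u v → Dec (S u v)) → Bounded S B → Tame S B
bounded-tame {S} {B} S? bounded = record
  { dec = S?
  ; stable-column = λ v B≤u → (λ s → beyond (proj₁ (bounded s)) B≤u) , (λ s → beyond (proj₁ (bounded s)) ≤-refl)
  ; stable-row = λ u B≤v → (λ s → beyond (proj₂ (bounded s)) B≤v) , (λ s → beyond (proj₂ (bounded s)) ≤-refl)
  }
  where
  beyond : ∀ {X : Set} {w} → w < B → B ≤ w → X
  beyond w<B B≤w = contradiction w<B (≤⇒≯ B≤w)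

pointRect : ℕ × ℕ → ℕ × ℕ
pointRect (u , v) = suc u , suc v

listSet⊆UnionRects : ∀ A → listSet A ⊆² UnionRects (map pointRect A)
listSet⊆UnionRects A u v uv∈A = Any.map⁺ (Any.map (λ { refl → n<1+n u , n<1+n v }) uv∈A)

listSet-tame : ∀ A → Tame (listSet A) (rectsBound (map pointRect A))
listSet-tame A = bounded-tame (λ u v → (u , v) ∈? A)
  (λ {u} {v} uv∈A → UnionRects-bounded (map pointRect A) (listSet⊆UnionRects A u v uv∈A))
  where open DecMembership (≡-dec _≟_ _≟_) using (_∈?_)

-- Deleting rows and columns

-- The ℕ analogues of Data.Fin's punchIn and punchOut.
punchIn : ℕ → ℕ → ℕ
punchIn r w with w <? r
... | yes _ = w
... | no _ = suc w

punchOut : ℕ → ℕ → ℕ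
punchOut r v with v <? r
... | yes _ = v
... | no _ = pred v

punchIn≢ : ∀ r w → punchIn r w ≢ r
punchIn≢ r w with w <? r
... | yes w<r = λ w≡r → <-irrefl w≡r w<r
... | no w≮r = λ 1+w≡r → w≮r (≤-reflexive 1+w≡r)

punchOut-punchIn : ∀ r w → punchOut r (punchIn r w) ≡ w
punchOut-punchIn r w with w <? r
... | yes w<r rewrite dec-yes (w <? r) w<r .proj₂ = refl
... | no w≮r with suc w <? r
...   | yes 1+w<r = contradiction (<-trans (n<1+n w) 1+w<r) w≮r
...   | no _ = refl

punchIn-punchOut : ∀ {r v} → v ≢ r → punchIn r (punchOut r v) ≡ v
punchIn-punchOut {r} {v} v≢r with v <? r
... | yes v<r rewrite dec-yes (v <? r) v<r .proj₂ = refl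
punchIn-punchOut {r} {zero} v≢r | no v≮r = contradiction (n≤0⇒n≡0 (≮⇒≥ v≮r)) (v≢r ∘ sym)
punchIn-punchOut {r} {suc k} v≢r | no v≮r with k <? r
... | yes k<r = contradiction (≤-antisym k<r (≮⇒≥ v≮r)) v≢r
... | no _ = refl

punchOut-injective : ∀ {r v v′} → v ≢ r → v′ ≢ r → punchOut r v ≡ punchOut r v′ → v ≡ v′
punchOut-injective {r} {v} {v′} v≢r v′≢r eq = begin
  v                          ≡⟨ punchIn-punchOut v≢r ⟨
  punchIn r (punchOut r v)   ≡⟨ cong (punchIn r) eq ⟩
  punchIn r (punchOut r v′)  ≡⟨ punchIn-punchOut v′≢r ⟩
  v′                         ∎
  where open ≡-Reasoning

ColAtLeast-punchOut : ∀ {S S′ : Set²} {u c} r → (∀ {v} → v ≢ r → S u v → S′ u (punchOut r v)) →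
  ColAtLeast S u c → ∃[ c′ ] (c ≤ c′ + 1 × ColAtLeast S′ u c′)
ColAtLeast-punchOut {S} {S′} {u} r simulate (vs , refl , uvs , all) =
  length vs′ , length-vs≤ , vs′ , refl , unique-vs′ ,
  All.map⁺ (All.map (λ (v≢r , s) → simulate v≢r s) all-offRow)
  where
  ≢r? : Decidable (_≢ r)
  ≢r? v = ¬? (v ≟ r)
  offRow vs′ : List ℕ
  offRow = filter ≢r? vs
  vs′ = map (punchOut r) offRow
  all-offRow : All (λ v → v ≢ r × S u v) offRow
  all-offRow = All.zip (All.all-filter ≢r? vs , All.filter⁺ ≢r? all)
  unique-vs′ : Unique vs′
  unique-vs′ = map-unique-on (punchOut r) punchOut-injective (All.map proj₁ all-offRow) (Unique.filter⁺ ≢r? uvs)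
  vs⊆ : vs ⊆ r ∷ offRow
  vs⊆ {v} v∈vs with v ≟ r
  ... | yes refl = here refl
  ... | no v≢r = there (∈-filter⁺ ≢r? v∈vs v≢r)
  length-vs≤ : length vs ≤ length vs′ + 1
  length-vs≤ = begin
    length vs               ≤⟨ Unique-⊆⇒length≤ _≟_ uvs vs⊆ ⟩
    suc (length offRow)     ≡⟨ +-comm 1 _ ⟩
    length offRow + 1       ≡⟨ cong (_+ 1) (length-map (punchOut r) offRow) ⟨
    length vs′ + 1          ∎
    where open ≤-Reasoning

offRow? : ∀ r → Decidable (λ (p : ℕ × ℕ) → proj₂ p ≢ r)
offRow? r p = ¬? (proj₂ p ≟ r)

punchOutRow : ℕ → ℕ × ℕ → ℕ × ℕ
punchOutRow r (u , v) = u , punchOut r v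

deleteRow : ℕ → List (ℕ × ℕ) → List (ℕ × ℕ)
deleteRow r A = map (punchOutRow r) (filter (offRow? r) A)

deleteRow-unique : ∀ r {A} → Unique A → Unique (deleteRow r A)
deleteRow-unique r {A} uA =
  map-unique-on (punchOutRow r) injective (All.all-filter (offRow? r) A) (Unique.filter⁺ (offRow? r) uA)
  where
  injective : ∀ {p q} → proj₂ p ≢ r → proj₂ q ≢ r → punchOutRow r p ≡ punchOutRow r q → p ≡ q
  injective p≢r q≢r eq = cong₂ _,_ (cong proj₁ eq) (punchOut-injective p≢r q≢r (cong proj₂ eq))

module _ {Z : Set²} (𝒵 : FiniteZeroSet Z) (r : ℕ) (A : List (ℕ × ℕ)) where
  open FiniteZeroSet 𝒵 using (down-closed)

  private
    S S′ : ℕ → Set²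
    S = growthIter Z (listSet A)
    S′ = growthIter (shiftDown 1 Z) (listSet (deleteRow r A))

  -- A point off row r keeps its row, and its column loses at most the point on row r, which the
  -- passage from Z to Z↓1 absorbs; tameness decides whether its image is already present.
  deleteRow-simulates : ∀ t {u v} → v ≢ r → S t u v → S′ t u (punchOut r v)
  deleteRow-simulates zero v≢r uv∈A = ∈-map⁺ (punchOutRow r) (∈-filter⁺ (offRow? r) uv∈A v≢r)
  deleteRow-simulates (suc t) v≢r (inj₁ s) = inj₁ (deleteRow-simulates t v≢r s)
  deleteRow-simulates (suc t) {u} {v} v≢r (inj₂ (_ , r′ , c , ∉Z , row , col))
    with Tame.dec (growthIter-tame (shiftDown-zeroSet 1 𝒵) (listSet-tame (deleteRow r A)) t) u (punchOut r v)
  ... | yes s′ = inj₁ s′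
  ... | no s′∉ =
    let c′ , c≤c′+1 , col′ = ColAtLeast-punchOut {S t} {S′ t} r (deleteRow-simulates t) col
    in inj₂ (s′∉ , r′ , c′ , ∉Z ∘ down-closed ≤-refl c≤c′+1 ,
             RowAtLeast-map {S t} {S′ t} (deleteRow-simulates t v≢r) row , col′)

  deleteRow-spans : Spans Z (listSet A) → Spans (shiftDown 1 Z) (listSet (deleteRow r A))
  deleteRow-spans spans u w =
    let t , s = spans u (punchIn r w)
    in t , subst (S′ t u) (punchOut-punchIn r w) (deleteRow-simulates t (punchIn≢ r w) s)

shiftDown-zero : ∀ Z → shiftDown 0 Z ≐ Z
shiftDown-zero Z u v = subst (Z u) (+-identityʳ v) , subst (Z u) (sym (+-identityʳ v))

shiftDown-shiftDown : ∀ Z m n → shiftDown m (shiftDown n Z) ≐ shiftDown (n + m) Z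
shiftDown-shiftDown Z m n u v = subst (Z u) (v+m+n≡v+[n+m]) , subst (Z u) (sym v+m+n≡v+[n+m])
  where
  v+m+n≡v+[n+m] : v + m + n ≡ v + (n + m)
  v+m+n≡v+[n+m] = trans (+-assoc v m n) (cong (v +_) (+-comm m n))

inRows? : ∀ R → Decidable (λ (p : ℕ × ℕ) → proj₂ p ∈ R)
inRows? R p = proj₂ p ∈ℕ? R

inColumns? : ∀ C → Decidable (λ (p : ℕ × ℕ) → proj₁ p ∈ C)
inColumns? C p = proj₁ p ∈ℕ? C

deleteRows-spans : ∀ n {Z} → FiniteZeroSet Z → ∀ R {A} → length R ≡ n → Unique R → Unique A →
  Spans Z (listSet A) →
  ∃[ A′ ] (Unique A′ × Spans (shiftDown n Z) (listSet A′)
           × length A′ ≤ length (filter (∁? (inRows? R)) A))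
deleteRows-spans zero {Z} 𝒵 [] {A} refl _ uA spans =
  A , uA , Spans-cong (≐-sym (shiftDown-zero Z)) ≐-refl spans ,
  ≤-reflexive (cong length (sym (filter-all (∁? (inRows? [])) (All.tabulate {xs = A} λ _ ()))))
deleteRows-spans (suc n) {Z} 𝒵 (r ∷ R) {A} lenR (r∉R ∷ uR) uA spans
  with deleteRows-spans n (shiftDown-zeroSet 1 𝒵) (map (punchOut r) R)
         (trans (length-map (punchOut r) R) (suc-injective lenR))
         (map-unique-on (punchOut r) punchOut-injective (All.map (_∘ sym) r∉R) uR)
         (deleteRow-unique r uA) (deleteRow-spans 𝒵 r A spans)
... | A′ , uA′ , spans′ , length-A′≤ =
  A′ , uA′ , Spans-cong (shiftDown-shiftDown Z n 1) ≐-refl spans′ ,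
  (begin
    length A′
      ≤⟨ length-A′≤ ⟩
    length (filter (∁? (inRows? R′)) (map (punchOutRow r) (filter (offRow? r) A)))
      ≡⟨ length-filter-map (∁? (inRows? R′)) (punchOutRow r) (filter (offRow? r) A) ⟩
    length (filter (∁? (inRows? R′) ∘ punchOutRow r) (filter (offRow? r) A))
      ≤⟨ length-filter-filter (offRow? r) (∁? (inRows? R′) ∘ punchOutRow r) (∁? (inRows? (r ∷ R)))
           (λ {p} → kept {p}) A ⟩
    length (filter (∁? (inRows? (r ∷ R))) A) ∎)
  where
  open ≤-Reasoning
  R′ : List ℕ
  R′ = map (punchOut r) R
  kept : ∀ {p : ℕ × ℕ} → proj₂ p ≢ r → punchOut r (proj₂ p) ∉ R′ → proj₂ p ∉ r ∷ R
  kept p≢r _ (here p≡r) = p≢r p≡r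
  kept _ ∉R′ (there ∈R) = ∉R′ (∈-map⁺ (punchOut r) ∈R)

deleteColumns-spans : ∀ n {Z} → FiniteZeroSet Z → ∀ C {A} → length C ≡ n → Unique C → Unique A →
  Spans Z (listSet A) →
  ∃[ A′ ] (Unique A′ × Spans (shiftLeft n Z) (listSet A′)
           × length A′ ≤ length (filter (∁? (inColumns? C)) A))
deleteColumns-spans n {Z} 𝒵 C {A} lenC uC uA spans
  with deleteRows-spans n (flip-zeroSet 𝒵) C lenC uC (Unique.map⁺ (cong swap) uA) (Spans-flip Z A spans)
... | A′ , uA′ , spans′ , length-A′≤ =
  map swap A′ , Unique.map⁺ (cong swap) uA′ , Spans-flip (shiftDown n (flip Z)) A′ spans′ ,
  ≤-trans (≤-reflexive (length-map swap A′))
    (≤-trans length-A′≤ (≤-reflexive (length-filter-map (∁? (inRows? C)) swap A)))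

-- The walk out of Y

FullColumn : ℕ → Set² → ℕ → Set
FullColumn b S c = Σ (List ℕ) λ vs → b ≤ length vs × Unique vs × All (S c) vs

FullRow : ℕ → Set² → ℕ → Set
FullRow a S v = Σ (List ℕ) λ us → a ≤ length us × Unique us × All (λ u → S u v) us

FullColumn-mono : ∀ {b S T} → S ⊆² T → ∀ {c} → FullColumn b S c → FullColumn b T c
FullColumn-mono S⊆T {c} (vs , b≤ , uvs , all) = vs , b≤ , uvs , All.map (S⊆T c _) all

FullRow-mono : ∀ {a S T} → S ⊆² T → ∀ {v} → FullRow a S v → FullRow a T v
FullRow-mono S⊆T {v} (us , a≤ , uus , all) = us , a≤ , uus , All.map (λ {u} → S⊆T u v) all

previous : (ℕ → Set²) → ℕ → Set²
previous S zero _ _ = ⊥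
previous S (suc t) = S t

module _ {Z : Set²} (S : Set²) where

  previous⊆growthIter : ∀ t → previous (growthIter Z S) t ⊆² growthIter Z S t
  previous⊆growthIter (suc t) u v = inj₁

  growthIter-mono : ∀ {t t′} → t ≤ t′ → growthIter Z S t ⊆² growthIter Z S t′
  growthIter-mono {t} {t′} t≤t′ u v = go (≤⇒≤′ t≤t′)
    where
    go : ∀ {t′} → t ≤′ t′ → growthIter Z S t u v → growthIter Z S t′ u v
    go ≤′-refl = id
    go (≤′-step t≤′t′) = inj₁ ∘ go t≤′t′

  growthIter-origin : ∀ {a b} → Rect a b ⊆² Z → ∀ t {u v} → growthIter Z S t u v →
    S u v ⊎ FullRow a (previous (growthIter Z S) t) v ⊎ FullColumn b (previous (growthIter Z S) t) u
  growthIter-origin R⊆Z zero s = inj₁ s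
  growthIter-origin R⊆Z (suc t) (inj₁ s) with growthIter-origin R⊆Z t s
  ... | inj₁ s₀ = inj₁ s₀
  ... | inj₂ (inj₁ row) = inj₂ (inj₁ (FullRow-mono (previous⊆growthIter t) row))
  ... | inj₂ (inj₂ col) = inj₂ (inj₂ (FullColumn-mono (previous⊆growthIter t) col))
  growthIter-origin {a} {b} R⊆Z (suc t) (inj₂ (_ , r , c , ∉Z , (us , refl , uus , all) , (vs , refl , uvs , all′)))
    with r <? a | c <? b
  ... | yes r<a | yes c<b = contradiction (R⊆Z r c (r<a , c<b)) ∉Z
  ... | no r≮a | _ = inj₂ (inj₁ (us , ≮⇒≥ r≮a , uus , all))
  ... | yes _ | no c≮b = inj₂ (inj₂ (vs , ≮⇒≥ c≮b , uvs , all′))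

∀<-eventually : ∀ {P : ℕ → ℕ → Set} → (∀ {i t t′} → t ≤ t′ → P i t → P i t′) →
  ∀ n → (∀ i → i < n → ∃ (P i)) → ∃[ T ] (∀ i → i < n → P i T)
∀<-eventually mono zero _ = 0 , λ _ ()
∀<-eventually {P} mono (suc n) eventually
  with T , below-n ← ∀<-eventually mono n (λ i i<n → eventually i (m≤n⇒m≤1+n i<n))
     | t , at-n ← eventually n ≤-refl = T ⊔ t , all-below
  where
  all-below : ∀ i → i < suc n → P i (T ⊔ t)
  all-below i i<1+n with m<1+n⇒m<n∨m≡n i<1+n
  ... | inj₁ i<n = mono (m≤m⊔n T t) (below-n i i<n)
  ... | inj₂ refl = mono (m≤n⊔m T t) at-n

column-balance-step : ∀ k ℓ {a b x y n x′} →
  k * b + ℓ * a ≤ x + y + k * ℓ → b ≤ n + ℓ → n + x ≤ x′ →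
  suc k * b + ℓ * a ≤ x′ + y + suc k * ℓ
column-balance-step k ℓ {a} {b} {x} {y} {n} {x′} balanced b≤ n+x≤ = begin
  suc k * b + ℓ * a             ≡⟨ +-assoc b (k * b) (ℓ * a) ⟩
  b + (k * b + ℓ * a)           ≤⟨ +-mono-≤ b≤ balanced ⟩
  (n + ℓ) + (x + y + k * ℓ)     ≡⟨ rearrange n ℓ x y (k * ℓ) ⟩
  (n + x) + y + (ℓ + k * ℓ)     ≤⟨ +-monoˡ-≤ (ℓ + k * ℓ) (+-monoˡ-≤ y n+x≤) ⟩
  x′ + y + suc k * ℓ            ∎
  where
  open ≤-Reasoning
  rearrange : ∀ n ℓ x y z → (n + ℓ) + (x + y + z) ≡ (n + x) + y + (ℓ + z)
  rearrange = solve-∀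

row-balance-step : ∀ k ℓ {a b x y n y′} →
  k * b + ℓ * a ≤ x + y + k * ℓ → a ≤ n + k → n + y ≤ y′ →
  k * b + suc ℓ * a ≤ x + y′ + k * suc ℓ
row-balance-step k ℓ {a} {b} {x} {y} {n} {y′} balanced a≤ n+y≤ = begin
  k * b + suc ℓ * a             ≡⟨ rearrange (k * b) a (ℓ * a) ⟩
  a + (k * b + ℓ * a)           ≤⟨ +-mono-≤ a≤ balanced ⟩
  (n + k) + (x + y + k * ℓ)     ≡⟨ rearrange′ n k x y (k * ℓ) ⟩
  x + (n + y) + (k + k * ℓ)     ≤⟨ +-monoˡ-≤ (k + k * ℓ) (+-monoʳ-≤ x n+y≤) ⟩
  x + y′ + (k + k * ℓ)          ≡⟨ cong (x + y′ +_) (*-suc k ℓ) ⟨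
  x + y′ + k * suc ℓ            ∎
  where
  open ≤-Reasoning
  rearrange : ∀ z a w → z + (a + w) ≡ a + (z + w)
  rearrange = solve-∀
  rearrange′ : ∀ n k x y z → (n + k) + (x + y + z) ≡ x + (n + y) + (k + z)
  rearrange′ = solve-∀

module Walk {Z Y : Set²} {a b : ℕ} (0<a : 0 < a) (0<b : 0 < b) (R⊆Z : Rect a b ⊆² Z)
  (Y? : ∀ k ℓ → Dec (Y k ℓ)) (Y00 : Y 0 0) (Y⊆R : Y ⊆² Rect (a ∸ 1) (b ∸ 1))
  (A : List (ℕ × ℕ)) (spans : Spans Z (listSet A)) where

  open RawMonad (¬¬-Monad {a = 0ℓ})

  S : ℕ → Set²
  S = growthIter Z (listSet A)

  inColumn? : ∀ c → Decidable (λ (p : ℕ × ℕ) → proj₁ p ≡ c)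
  inColumn? c p = proj₁ p ≟ c

  inRow? : ∀ v → Decidable (λ (p : ℕ × ℕ) → proj₂ p ≡ v)
  inRow? v p = proj₂ p ≟ v

  Balanced : List ℕ → List ℕ → Set
  Balanced C R = length C * b + length R * a
    ≤ length (filter (inColumns? C) A) + length (filter (inRows? R) A) + length C * length R

  record Invariant (T : ℕ) (C R : List ℕ) : Set where
    field
      unique-C : Unique C
      unique-R : Unique R
      full-columns∈ : ∀ {c} → FullColumn b (previous S T) c → c ∈ C
      full-rows∈ : ∀ {v} → FullRow a (previous S T) v → v ∈ R
      inY : Y (length C) (length R)
      balanced : Balanced C R

  record Exit : Set where
    field
      C R : List ℕ
      unique-C : Unique C
      unique-R : Unique R
      boundary : OutBoundary Y (length C) (length R)
      balanced : Balanced C R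

  module _ {T C R} (I : Invariant T C R) where
    open Invariant I

    column-points : ∀ {c} → c ∉ C → FullColumn b (S T) c → b ≤ length (filter (inColumn? c) A) + length R
    column-points {c} c∉C (vs , b≤ , uvs , all) = begin
      b                                  ≤⟨ b≤ ⟩
      length vs                          ≤⟨ Unique-⊆⇒length≤ _≟_ uvs vs⊆ ⟩
      length (column ++ R)               ≡⟨ length-++ column ⟩
      length column + length R           ≡⟨ cong (_+ length R) (length-map proj₂ (filter (inColumn? c) A)) ⟩
      length (filter (inColumn? c) A) + length R ∎
      where
      open ≤-Reasoning
      column : List ℕ
      column = map proj₂ (filter (inColumn? c) A)
      vs⊆ : vs ⊆ column ++ R
      vs⊆ {v} v∈vs with growthIter-origin (listSet A) R⊆Z T (All.lookup all v∈vs)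
      ... | inj₁ cv∈A = ∈-++⁺ˡ (∈-map⁺ proj₂ (∈-filter⁺ (inColumn? c) cv∈A refl))
      ... | inj₂ (inj₁ row) = ∈-++⁺ʳ column (full-rows∈ row)
      ... | inj₂ (inj₂ col) = contradiction (full-columns∈ col) c∉C

    row-points : ∀ {v} → v ∉ R → FullRow a (S T) v → a ≤ length (filter (inRow? v) A) + length C
    row-points {v} v∉R (us , a≤ , uus , all) = begin
      a                                  ≤⟨ a≤ ⟩
      length us                          ≤⟨ Unique-⊆⇒length≤ _≟_ uus us⊆ ⟩
      length (row ++ C)                  ≡⟨ length-++ row ⟩
      length row + length C              ≡⟨ cong (_+ length C) (length-map proj₁ (filter (inRow? v) A)) ⟩
      length (filter (inRow? v) A) + length C ∎
      where
      open ≤-Reasoning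
      row : List ℕ
      row = map proj₁ (filter (inRow? v) A)
      us⊆ : us ⊆ row ++ C
      us⊆ {u} u∈us with growthIter-origin (listSet A) R⊆Z T (All.lookup all u∈us)
      ... | inj₁ uv∈A = ∈-++⁺ˡ (∈-map⁺ proj₁ (∈-filter⁺ (inRow? v) uv∈A refl))
      ... | inj₂ (inj₁ row′) = contradiction (full-rows∈ row′) v∉R
      ... | inj₂ (inj₂ col) = ∈-++⁺ʳ row (full-columns∈ col)

    column-balanced : ∀ {c} → c ∉ C → FullColumn b (S T) c → Balanced (c ∷ C) R
    column-balanced {c} c∉C full = column-balance-step (length C) (length R) balanced (column-points c∉C full)
      (length-filter-disjoint (inColumn? c) (inColumns? C) (inColumns? (c ∷ C))
        (λ { refl c∈C → c∉C c∈C }) here there A)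

    row-balanced : ∀ {v} → v ∉ R → FullRow a (S T) v → Balanced C (v ∷ R)
    row-balanced {v} v∉R full = row-balance-step (length C) (length R) balanced (row-points v∉R full)
      (length-filter-disjoint (inRow? v) (inRows? R) (inRows? (v ∷ R))
        (λ { refl v∈R → v∉R v∈R }) here there A)

    add-column : ∀ {c} → c ∉ C → FullColumn b (S T) c → Y (suc (length C)) (length R) → Invariant T (c ∷ C) R
    add-column c∉C full inY′ = record
      { unique-C = ∷-unique c∉C unique-C ; unique-R = unique-R
      ; full-columns∈ = there ∘ full-columns∈ ; full-rows∈ = full-rows∈
      ; inY = inY′ ; balanced = column-balanced c∉C full }

    add-row : ∀ {v} → v ∉ R → FullRow a (S T) v → Y (length C) (suc (length R)) → Invariant T C (v ∷ R)
    add-row v∉R full inY′ = record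
      { unique-C = unique-C ; unique-R = ∷-unique v∉R unique-R
      ; full-columns∈ = full-columns∈ ; full-rows∈ = there ∘ full-rows∈
      ; inY = inY′ ; balanced = row-balanced v∉R full }

    exit-column : ∀ {c} → c ∉ C → FullColumn b (S T) c → ¬ Y (suc (length C)) (length R) → Exit
    exit-column {c} c∉C full ∉Y = record
      { C = c ∷ C ; R = R ; unique-C = ∷-unique c∉C unique-C ; unique-R = unique-R
      ; boundary = ∉Y , inj₁ (length C , refl , inY) ; balanced = column-balanced c∉C full }

    exit-row : ∀ {v} → v ∉ R → FullRow a (S T) v → ¬ Y (length C) (suc (length R)) → Exit
    exit-row {v} v∉R full ∉Y = record
      { C = C ; R = v ∷ R ; unique-C = unique-C ; unique-R = ∷-unique v∉R unique-R
      ; boundary = ∉Y , inj₂ (length R , refl , inY) ; balanced = row-balanced v∉R full }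

    advance : ¬ (∃[ c ] (c ∉ C × FullColumn b (S T) c)) → ¬ (∃[ v ] (v ∉ R × FullRow a (S T) v)) →
      Invariant (suc T) C R
    advance no-new-column no-new-row = record
      { unique-C = unique-C ; unique-R = unique-R
      ; full-columns∈ = λ {c} full → decidable-stable (c ∈ℕ? C) (λ c∉C → no-new-column (c , c∉C , full))
      ; full-rows∈ = λ {v} full → decidable-stable (v ∈ℕ? R) (λ v∉R → no-new-row (v , v∉R , full))
      ; inY = inY ; balanced = balanced }

    length-C+length-R<a+b : length C + length R < a + b
    length-C+length-R<a+b =
      let k<a-1 , ℓ<b-1 = Y⊆R _ _ inY
      in +-mono-< (<-≤-trans k<a-1 (m∸n≤m a 1)) (<-≤-trans ℓ<b-1 (m∸n≤m b 1))

  saturate : ∀ e {T C R} → a + b ≤ length C + length R + e → Invariant T C R →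
    DoubleNegation (Exit ⊎ ∃[ C′ ] ∃[ R′ ] Invariant (suc T) C′ R′)
  saturate zero fuel I =
    contradiction (≤-trans fuel (≤-reflexive (+-identityʳ _))) (<⇒≱ (length-C+length-R<a+b I))
  saturate (suc e) {T} {C} {R} fuel I = do
    new-column? ← ¬¬-excluded-middle
    new-row? ← ¬¬-excluded-middle
    step new-column? new-row?
    where
    open Invariant I
    fuel′ : ∀ k ℓ → suc (length C + length R) ≡ k + ℓ → a + b ≤ k + ℓ + e
    fuel′ k ℓ eq = ≤-trans fuel (≤-reflexive (trans (+-suc _ e) (cong (_+ e) eq)))
    step : Dec (∃[ c ] (c ∉ C × FullColumn b (S T) c)) → Dec (∃[ v ] (v ∉ R × FullRow a (S T) v)) →
      DoubleNegation (Exit ⊎ ∃[ C′ ] ∃[ R′ ] Invariant (suc T) C′ R′)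
    step (yes (c , c∉C , full)) _ with Y? (suc (length C)) (length R)
    ... | yes inY′ = saturate e (fuel′ (suc (length C)) (length R) refl) (add-column I c∉C full inY′)
    ... | no ∉Y = pure (inj₁ (exit-column I c∉C full ∉Y))
    step (no _) (yes (v , v∉R , full)) with Y? (length C) (suc (length R))
    ... | yes inY′ = saturate e (fuel′ (length C) (suc (length R)) (sym (+-suc _ _))) (add-row I v∉R full inY′)
    ... | no ∉Y = pure (inj₁ (exit-row I v∉R full ∉Y))
    step (no no-new-column) (no no-new-row) = pure (inj₂ (C , R , advance I no-new-column no-new-row))

  columns-eventually-full : ∃[ T ] (∀ c → c < a → FullColumn b (S T) c)
  columns-eventually-full =
    ∀<-eventually (λ t≤t′ → FullColumn-mono (growthIter-mono (listSet A) t≤t′)) a column-full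
    where
    column-full : ∀ c → c < a → ∃[ t ] FullColumn b (S t) c
    column-full c _ =
      let t , points = ∀<-eventually (λ {v} t≤t′ → growthIter-mono (listSet A) t≤t′ c v) b
                         (λ v _ → spans c v)
      in t , upTo b , ≤-reflexive (sym (length-upTo b)) , Unique.upTo⁺ b , All.tabulate (points _ ∘ ∈-upTo⁻)

  T₀ : ℕ
  T₀ = proj₁ columns-eventually-full

  walk : ∀ d {T C R} → d + T ≡ suc T₀ → Invariant T C R → DoubleNegation Exit
  walk zero {C = C} refl I = contradiction (<-≤-trans k<a-1 (m∸n≤m a 1)) (≤⇒≯ a≤k)
    where
    open Invariant I
    k<a-1 : length C < a ∸ 1
    k<a-1 = proj₁ (Y⊆R _ _ inY)
    a≤k : a ≤ length C
    a≤k = begin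
      a              ≡⟨ length-upTo a ⟨
      length (upTo a) ≤⟨ Unique-⊆⇒length≤ _≟_ (Unique.upTo⁺ a)
                           (full-columns∈ ∘ proj₂ columns-eventually-full _ ∘ ∈-upTo⁻) ⟩
      length C       ∎
      where open ≤-Reasoning
  walk (suc d) {T} {C} {R} eq I = do
    inj₂ (C′ , R′ , I′) ← saturate (a + b) (m≤n+m (a + b) (length C + length R)) I
      where inj₁ exit → pure exit
    walk d (trans (+-suc d T) eq) I′

  initial : Invariant 0 [] []
  initial = record
    { unique-C = [] ; unique-R = []
    ; full-columns∈ = λ where
        ([] , b≤0 , _) → contradiction b≤0 (<⇒≱ 0<b)
        (_ ∷ _ , _ , _ , () ∷ _)
    ; full-rows∈ = λ where
        ([] , a≤0 , _) → contradiction a≤0 (<⇒≱ 0<a)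
        (_ ∷ _ , _ , _ , () ∷ _)
    ; inY = Y00 ; balanced = z≤n }

  exit : DoubleNegation Exit
  exit = walk (suc T₀) (+-identityʳ (suc T₀)) initial

  Exit-bound : (e : Exit) → let open Exit e in
    length C * b + length R * a ∸ length C * length R
      + length (filter (∁? (inRows? R)) A) + length (filter (∁? (inColumns? C)) A) ≤ 2 * length A
  Exit-bound e = begin
    k * b + ℓ * a ∸ k * ℓ + outRows + outColumns
      ≤⟨ +-monoˡ-≤ outColumns (+-monoˡ-≤ outRows (m≤n+o⇒m∸n≤o (k * b + ℓ * a) (k * ℓ)
           (≤-trans balanced (≤-reflexive (+-comm _ (k * ℓ)))))) ⟩
    inColumns + inRows + outRows + outColumns
      ≡⟨ rearrange inColumns inRows outRows outColumns ⟩
    (outRows + inRows) + (outColumns + inColumns)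
      ≡⟨ cong₂ _+_ (length-filter-∁+length-filter (inRows? R) A)
                   (length-filter-∁+length-filter (inColumns? C) A) ⟩
    length A + length A
      ≡⟨ cong (length A +_) (+-identityʳ (length A)) ⟨
    2 * length A ∎
    where
    open Exit e
    open ≤-Reasoning
    k ℓ inColumns inRows outColumns outRows : ℕ
    k = length C
    ℓ = length R
    inColumns = length (filter (inColumns? C) A)
    inRows = length (filter (inRows? R) A)
    outColumns = length (filter (∁? (inColumns? C)) A)
    outRows = length (filter (∁? (inRows? R)) A)
    rearrange : ∀ x y z w → x + y + z + w ≡ (z + y) + (w + x)
    rearrange = solve-∀

OutBoundary-bounded : ∀ {Y a b} → 0 < a → 0 < b → Y ⊆² Rect (a ∸ 1) (b ∸ 1) →
  ∀ {k ℓ} → OutBoundary Y k ℓ → k < a × ℓ < b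
OutBoundary-bounded {a = suc a} {suc b} _ _ Y⊆R (_ , inj₁ (k , refl , inY)) =
  let k<a , ℓ<b = Y⊆R _ _ inY in s≤s k<a , m≤n⇒m≤1+n ℓ<b
OutBoundary-bounded {a = suc a} {suc b} _ _ Y⊆R (_ , inj₂ (ℓ , refl , inY)) =
  let k<a , ℓ<b = Y⊆R _ _ inY in m≤n⇒m≤1+n k<a , s≤s ℓ<b

OutBoundary? : ∀ {Y} → (∀ k ℓ → Dec (Y k ℓ)) → ∀ k ℓ → Dec (OutBoundary Y k ℓ)
OutBoundary? {Y} Y? k ℓ = ¬? (Y? k ℓ) ×-dec (left? k ⊎-dec below? ℓ)
  where
  left? : ∀ k → Dec (∃[ k′ ] (k ≡ suc k′ × Y k′ ℓ))
  left? zero = no λ ()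
  left? (suc k′) = map′ (λ y → k′ , refl , y) (λ { (_ , refl , y) → y }) (Y? k′ ℓ)
  below? : ∀ ℓ → Dec (∃[ ℓ′ ] (ℓ ≡ suc ℓ′ × Y k ℓ′))
  below? zero = no λ ()
  below? (suc ℓ′) = map′ (λ y → ℓ′ , refl , y) (λ { (_ , refl , y) → y }) (Y? k ℓ′)

bounded-∃₂-stable : ∀ {P : ℕ → ℕ → Set} → (∀ k ℓ → Dec (P k ℓ)) → ∀ {a b} →
  DoubleNegation (∃[ k ] (k < a × ∃[ ℓ ] (ℓ < b × P k ℓ))) → ∃[ k ] ∃[ ℓ ] P k ℓ
bounded-∃₂-stable P? {a} {b} ¬¬p with decidable-stable (anyUpTo? (λ k → anyUpTo? (P? k) b) a) ¬¬p
... | k , _ , ℓ , _ , p = k , ℓ , p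

theorem2p11 : (zs : List (ℕ × ℕ)) (a b : ℕ) → 0 < a → 0 < b →
  Rect a b ⊆² UnionRects zs →
  (ys : List (ℕ × ℕ)) → UnionRects ys 0 0 →
  UnionRects ys ⊆² Rect (a ∸ 1) (b ∸ 1) →
  (g : ℕ) → IsGamma (UnionRects zs) g →
  (gDown gLeft : ℕ → ℕ) →
  (∀ ℓ → IsGamma (shiftDown ℓ (UnionRects zs)) (gDown ℓ)) →
  (∀ k → IsGamma (shiftLeft k (UnionRects zs)) (gLeft k)) →
  ∃[ k ] ∃[ ℓ ] (OutBoundary (UnionRects ys) k ℓ
    × (k * b + ℓ * a ∸ k * ℓ + gDown ℓ + gLeft k ≤ 2 * g))
theorem2p11 zs a b 0<a 0<b R⊆Z ys Y00 Y⊆R g ((A , uA , refl , spans) , _) gDown gLeft γ↓ γ← =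
  bounded-∃₂-stable (λ k ℓ → OutBoundary? Y? k ℓ ×-dec (_ ≤? _)) (λ ¬goal → exit (¬goal ∘ goal))
  where
  Y? : ∀ k ℓ → Dec (UnionRects ys k ℓ)
  Y? = FiniteZeroSet.dec (UnionRects-zeroSet ys)

  open Walk 0<a 0<b R⊆Z Y? Y00 Y⊆R A spans

  γ↓≤ : ∀ R → Unique R → gDown (length R) ≤ length (filter (∁? (inRows? R)) A)
  γ↓≤ R uR =
    let A′ , uA′ , spans′ , |A′|≤ = deleteRows-spans (length R) (UnionRects-zeroSet zs) R refl uR uA spans
    in ≤-trans (proj₂ (γ↓ (length R)) A′ uA′ spans′) |A′|≤

  γ←≤ : ∀ C → Unique C → gLeft (length C) ≤ length (filter (∁? (inColumns? C)) A)
  γ←≤ C uC =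
    let A′ , uA′ , spans′ , |A′|≤ = deleteColumns-spans (length C) (UnionRects-zeroSet zs) C refl uC uA spans
    in ≤-trans (proj₂ (γ← (length C)) A′ uA′ spans′) |A′|≤

  goal : Exit → ∃[ k ] (k < a × ∃[ ℓ ] (ℓ < b × (OutBoundary (UnionRects ys) k ℓ
           × (k * b + ℓ * a ∸ k * ℓ + gDown ℓ + gLeft k ≤ 2 * length A))))
  goal e =
    let open Exit e
        k<a , ℓ<b = OutBoundary-bounded 0<a 0<b Y⊆R boundary
    in length C , k<a , length R , ℓ<b , boundary ,
       ≤-trans (+-mono-≤ (+-monoʳ-≤ _ (γ↓≤ R unique-R)) (γ←≤ C unique-C)) (Exit-bound e)
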